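{- Let $r\ge1$, $n\ge2$. For $w=x_1x_2\cdots x_n$ a nonincreasing word with letters in $\{0,\dots,r-1\}$ and $1\le i\le n-1$, define $$v=(x_1+1)(x_2+1)\cdots(x_i+1)\,x_n\,x_{n-1}\cdots x_{i+1}.$$ Then $(w,i)\mapsto v$ is a bijection from $D_n(r)$ onto $V_n(r)$, and it satisfies $\mathrm{dec}\,v=i$ and $\mathrm{tot}\,v=\mathrm{tot}\,w+i$.
   Context: $D_n(r)$ is the set of pairs $(w,i)$ with $w$ a nonincreasing word of length $n$ over $\{0,\dots,r-1\}$ and $1\le i\le n-1$. A $V$-word is a word $y_1\cdots y_n$ of nonnegative integers, $n\ge2$, such that for some $i$ with $1\le i\le n-1$: $y_1\ge\cdots\ge y_i>y_{i+1}$ and $y_{i+1}\le y_{i+2}\le\cdots\le y_n<y_i$. $V_n(r)$ is the set of $V$-words of length $n$ with letters at most $r$. $\mathrm{tot}$ is the sum of letters; for $w=x_1\cdots x_n$, $i\in\{1,\dots,n-1\}$ is a decrease if $x_i\ge x_{i+1}\ge\cdots\ge x_j>x_{j+1}$ for some $i\le j\le n-1$, and $\mathrm{dec}\,w$ is the number of decreases. -}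

module Defs where

open import Data.Nat using (ℕ; zero; suc; _+_; _≤_; _<_; _≥_; _>_; _≤?_; _<?_)
open import Data.Nat.Properties using (anyUpTo?; allUpTo?)
open import Data.List using (List; []; _∷_; length; map; take; drop; reverse; _++_; filter; upTo)
open import Data.Nat.ListAction using (sum)
open import Data.List.Relation.Unary.All using (All)
open import Data.List.Relation.Unary.Linked using (Linked)
open import Data.Product using (_×_; ∃)
open import Relation.Binary.PropositionalEquality using (_≡_)
open import Relation.Nullary using (Dec)
open import Relation.Nullary.Decidable using (_×-dec_; _→-dec_)

Word : Set
Word = List ℕ

-- 1-indexed letter access: w ! k = x_k for 1 ≤ k ≤ length w
-- (returns 0 out of range; never used out of range below).
_!_ : Word → ℕ → ℕ
[] ! _ = 0
(x ∷ xs) ! zero = 0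
(x ∷ xs) ! suc zero = x
(x ∷ xs) ! suc (suc k) = xs ! suc k

tot : Word → ℕ
tot = sum

Nonincreasing : Word → Set
Nonincreasing = Linked _≥_

InD : ℕ → ℕ → Word → ℕ → Set
InD n r w i = length w ≡ n × Nonincreasing w × All (_< r) w × 1 ≤ i × i < n

IsVWord : Word → Set
IsVWord y =
  2 ≤ n ×
  ∃ λ i → 1 ≤ i × i < n
        × (∀ k → 1 ≤ k → k < i → y ! k ≥ y ! suc k)
        × y ! i > y ! suc i
        × (∀ k → suc i ≤ k → k < n → y ! k ≤ y ! suc k)
        × y ! n < y ! i
  where n = length y

InV : ℕ → ℕ → Word → Set
InV n r y = length y ≡ n × IsVWord y × All (_≤ r) y

IsDecrease : Word → ℕ → Set
IsDecrease x i =
  1 ≤ i × i < n ×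
  ∃ λ j → j < n × (i ≤ j × (∀ {k} → k < j → (i ≤ k → x ! k ≥ x ! suc k)) × x ! j > x ! suc j)
  where n = length x

isDecrease? : ∀ x i → Dec (IsDecrease x i)
isDecrease? x i =
  (1 ≤? i) ×-dec ((i <? n) ×-dec
    anyUpTo? (λ j → (i ≤? j) ×-dec (allUpTo? (λ k → (i ≤? k) →-dec (x ! suc k ≤? x ! k)) j
                                    ×-dec (x ! suc j <? x ! j))) n)
  where n = length x

dec : Word → ℕ
dec x = length (filter (isDecrease? x) (upTo (length x)))

φ : Word → ℕ → Word
φ w i = map suc (take i w) ++ reverse (drop i w)

-- Cutting a nonincreasing word w = T D after position i, the word v = (T+1) (reverse D)
-- falls strictly from its i-th letter (the last of T+1, which exceeds every letter of D)
-- and then rises, ending on the first letter of D, which is still below that i-th letter: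
-- it is a V-word whose decreases are exactly 1, …, i. Conversely a V-word whose descent
-- ends at i splits at i into a nonincreasing and a nondecreasing part with these
-- inequalities between their ends, and undoing the construction there recovers (w , i).

module Submission where

open import Defs
open import Data.Nat using (ℕ; zero; suc; pred; _+_; _≤_; _<_; _≥_; _>_; z≤n; s≤s)
open import Data.Nat.Properties
open import Data.Nat.ListAction using (sum)
open import Data.Nat.ListAction.Properties using (sum-++; sum-↭)
open import Data.List using (List; []; _∷_; length; map; take; drop; reverse; _++_; _ʳ++_; filter; upTo; applyUpTo)
open import Data.List.Properties
  using (length-++; length-map; length-reverse; length-take; length-drop; take++drop≡id;
         reverse-involutive; unfold-reverse; map-∘; map-id; map-id-local; filter-accept; filter-reject)
open import Data.List.Relation.Unary.All as All using (All; []; _∷_)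
open import Data.List.Relation.Unary.All.Properties using (++⁺; ++⁻ˡ; map⁺; take⁺; drop⁺)
open import Data.List.Relation.Unary.Linked as Linked using (Linked; []; [-]; _∷_)
import Data.List.Relation.Unary.Linked.Properties as Linked
open import Data.List.Relation.Binary.Permutation.Propositional using (↭-sym)
open import Data.List.Relation.Binary.Permutation.Propositional.Properties using (All-resp-↭; ↭-reverse)
open import Data.Product using (_×_; ∃; _,_)
open import Function using (flip; _∘_)
open import Relation.Binary.PropositionalEquality
open import Relation.Nullary using (¬_)
open import Relation.Unary using (Decidable)
open import Algebra.Properties.CommutativeSemigroup +-commutativeSemigroup using (xy∙z≈xz∙y)

first : Word → ℕ
first xs = xs ! 1

final : Word → ℕ
final xs = xs ! length xs

!-++-length : ∀ xs {ys} → 1 ≤ length xs → (xs ++ ys) ! length xs ≡ final xs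
!-++-length (x ∷ []) _ = refl
!-++-length (x ∷ x′ ∷ xs) _ = !-++-length (x′ ∷ xs) (s≤s z≤n)

!-++-suc-length : ∀ xs ys → (xs ++ ys) ! suc (length xs) ≡ first ys
!-++-suc-length [] ys = refl
!-++-suc-length (x ∷ xs) ys = !-++-suc-length xs ys

final-++ : ∀ xs {ys} → 1 ≤ length ys → final (xs ++ ys) ≡ final ys
final-++ [] _ = refl
final-++ (x ∷ []) {y ∷ ys} _ = refl
final-++ (x ∷ x′ ∷ xs) p = final-++ (x′ ∷ xs) p

final-map : ∀ (f : ℕ → ℕ) xs → 1 ≤ length xs → final (map f xs) ≡ f (final xs)
final-map f (x ∷ []) _ = refl
final-map f (x ∷ x′ ∷ xs) _ = final-map f (x′ ∷ xs) (s≤s z≤n)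

final-reverse : ∀ xs → final (reverse xs) ≡ first xs
final-reverse [] = refl
final-reverse (x ∷ xs) = trans (cong final (unfold-reverse x xs)) (final-++ (reverse xs) (s≤s z≤n))

first-reverse : ∀ xs → first (reverse xs) ≡ final xs
first-reverse xs = trans (sym (final-reverse (reverse xs))) (cong final (reverse-involutive xs))

All-final : ∀ {P : ℕ → Set} {xs} → All P xs → 1 ≤ length xs → P (final xs)
All-final (p ∷ []) _ = p
All-final (_ ∷ ps@(_ ∷ _)) _ = All-final ps (s≤s z≤n)

module _ {R : ℕ → ℕ → Set} where

  Linked⇒! : ∀ {xs} → Linked R xs → ∀ {k} → 1 ≤ k → suc k ≤ length xs → R (xs ! k) (xs ! suc k)
  Linked⇒! [-] {suc zero} _ (s≤s ())
  Linked⇒! (r ∷ _) {suc zero} _ _ = r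
  Linked⇒! (_ ∷ l) {suc (suc k)} _ (s≤s q) = Linked⇒! l (s≤s z≤n) q

  !⇒Linked : ∀ xs → (∀ {k} → 1 ≤ k → suc k ≤ length xs → R (xs ! k) (xs ! suc k)) → Linked R xs
  !⇒Linked [] _ = []
  !⇒Linked (x ∷ []) _ = [-]
  !⇒Linked (x ∷ x′ ∷ xs) h =
    h {1} (s≤s z≤n) (s≤s (s≤s z≤n)) ∷ !⇒Linked (x′ ∷ xs) λ { {suc k} _ q → h {suc (suc k)} (s≤s z≤n) (s≤s q) }

  Linked⇒!-++ˡ : ∀ {xs} → Linked R xs → ∀ ys {k} → 1 ≤ k → suc k ≤ length xs →
                 R ((xs ++ ys) ! k) ((xs ++ ys) ! suc k)
  Linked⇒!-++ˡ [-] ys {suc zero} _ (s≤s ())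
  Linked⇒!-++ˡ (r ∷ _) ys {suc zero} _ _ = r
  Linked⇒!-++ˡ (_ ∷ l) ys {suc (suc k)} _ (s≤s q) = Linked⇒!-++ˡ l ys (s≤s z≤n) q

  !-++ˡ⇒Linked : ∀ xs ys → (∀ {k} → 1 ≤ k → suc k ≤ length xs → R ((xs ++ ys) ! k) ((xs ++ ys) ! suc k)) →
                 Linked R xs
  !-++ˡ⇒Linked [] ys _ = []
  !-++ˡ⇒Linked (x ∷ []) ys _ = [-]
  !-++ˡ⇒Linked (x ∷ x′ ∷ xs) ys h =
    h {1} (s≤s z≤n) (s≤s (s≤s z≤n)) ∷ !-++ˡ⇒Linked (x′ ∷ xs) ys λ { {suc k} _ q → h {suc (suc k)} (s≤s z≤n) (s≤s q) }

  Linked⇒!-++ʳ : ∀ {ys} → Linked R ys → ∀ xs {k} → suc (length xs) ≤ k → suc k ≤ length (xs ++ ys) →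
                 R ((xs ++ ys) ! k) ((xs ++ ys) ! suc k)
  Linked⇒!-++ʳ l [] p q = Linked⇒! l p q
  Linked⇒!-++ʳ l (x ∷ xs) {suc (suc k)} (s≤s p) (s≤s q) = Linked⇒!-++ʳ l xs p q

  !-++ʳ⇒Linked : ∀ xs ys → (∀ {k} → suc (length xs) ≤ k → suc k ≤ length (xs ++ ys) →
                 R ((xs ++ ys) ! k) ((xs ++ ys) ! suc k)) → Linked R ys
  !-++ʳ⇒Linked [] ys h = !⇒Linked ys h
  !-++ʳ⇒Linked (x ∷ xs) ys h = !-++ʳ⇒Linked xs ys λ { {suc k} p q → h {suc (suc k)} (s≤s p) (s≤s q) }

  Linked-++⁺ : ∀ {xs ys} → Linked R xs → Linked R ys → R (final xs) (first ys) → Linked R (xs ++ ys)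
  Linked-++⁺ [] l _ = l
  Linked-++⁺ [-] [] _ = [-]
  Linked-++⁺ [-] [-] r = r ∷ [-]
  Linked-++⁺ [-] (r′ ∷ l) r = r ∷ r′ ∷ l
  Linked-++⁺ (r′ ∷ l) l′ r = r′ ∷ Linked-++⁺ l l′ r

  Linked-++⁻ˡ : ∀ xs {ys} → Linked R (xs ++ ys) → Linked R xs
  Linked-++⁻ˡ [] _ = []
  Linked-++⁻ˡ (x ∷ []) _ = [-]
  Linked-++⁻ˡ (x ∷ x′ ∷ xs) (r ∷ l) = r ∷ Linked-++⁻ˡ (x′ ∷ xs) l

  Linked-++⁻ʳ : ∀ xs {ys} → Linked R (xs ++ ys) → Linked R ys
  Linked-++⁻ʳ [] l = l
  Linked-++⁻ʳ (x ∷ xs) l = Linked-++⁻ʳ xs (Linked.tail l)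

  Linked-++⇒final-first : ∀ xs {ys} → 1 ≤ length xs → 1 ≤ length ys → Linked R (xs ++ ys) → R (final xs) (first ys)
  Linked-++⇒final-first (x ∷ []) {y ∷ ys} _ _ (r ∷ _) = r
  Linked-++⇒final-first (x ∷ x′ ∷ xs) _ q (_ ∷ l) = Linked-++⇒final-first (x′ ∷ xs) (s≤s z≤n) q l

  Linked-ʳ++ : ∀ {x xs acc} → Linked R (x ∷ xs) → Linked (flip R) (x ∷ acc) → Linked (flip R) (xs ʳ++ x ∷ acc)
  Linked-ʳ++ [-] l = l
  Linked-ʳ++ (r ∷ l) l′ = Linked-ʳ++ l (r ∷ l′)

  Linked-reverse : ∀ {xs} → Linked R xs → Linked (flip R) (reverse xs)
  Linked-reverse {[]} _ = []
  Linked-reverse {_ ∷ _} l = Linked-ʳ++ l [-]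

  module _ (R-refl : ∀ {x} → R x x) (R-trans : ∀ {x y z} → R x y → R y z → R x z) where

    Linked⇒All-final : ∀ {xs} → Linked R xs → All (λ z → R z (final xs)) xs
    Linked⇒All-final [] = []
    Linked⇒All-final [-] = R-refl ∷ []
    Linked⇒All-final (r ∷ l) with Linked⇒All-final l
    ... | p ∷ ps = R-trans r p ∷ p ∷ ps

    Linked⇒first-final : ∀ {xs} → Linked R xs → 1 ≤ length xs → R (first xs) (final xs)
    Linked⇒first-final l p with Linked⇒All-final l
    ... | q ∷ _ = q

length-filter-applyUpTo : ∀ {P : ℕ → Set} (P? : Decidable P) f {m j} → j ≤ m →
  (∀ {k} → k < j → P (f k)) → (∀ {k} → j ≤ k → k < m → ¬ P (f k)) →
  length (filter P? (applyUpTo f m)) ≡ j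
length-filter-applyUpTo P? f {zero} z≤n _ _ = refl
length-filter-applyUpTo P? f {suc m} {zero} _ _ fails =
  trans (cong length (filter-reject P? (fails z≤n (s≤s z≤n))))
        (length-filter-applyUpTo P? (f ∘ suc) z≤n (λ ()) (λ _ k<m → fails z≤n (s≤s k<m)))
length-filter-applyUpTo P? f {suc m} {suc j} (s≤s j≤m) holds fails =
  trans (cong length (filter-accept P? (holds (s≤s z≤n))))
        (cong suc (length-filter-applyUpTo P? (f ∘ suc) j≤m (holds ∘ s≤s) (λ j≤k k<m → fails (s≤s j≤k) (s≤s k<m))))

length-filter-upTo : ∀ {P : ℕ → Set} (P? : Decidable P) {n j} → j < n → ¬ P 0 →
  (∀ {k} → 1 ≤ k → k ≤ j → P k) → (∀ {k} → j < k → k < n → ¬ P k) →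
  length (filter P? (upTo n)) ≡ j
length-filter-upTo P? {suc m} (s≤s j≤m) ¬P0 holds fails =
  trans (cong length (filter-reject P? ¬P0))
        (length-filter-applyUpTo P? suc j≤m (holds (s≤s z≤n)) (λ j≤k k<m → fails (s≤s j≤k) (s≤s k<m)))

record IsVWordAt (y : Word) (i : ℕ) : Set where
  field
    1≤i : 1 ≤ i
    i<n : i < length y
    nonincreasing-before : ∀ k → 1 ≤ k → k < i → y ! k ≥ y ! suc k
    descent-at : y ! i > y ! suc i
    nondecreasing-after : ∀ k → suc i ≤ k → k < length y → y ! k ≤ y ! suc k
    final<y!i : y ! length y < y ! i

IsVWordAt⇒IsVWord : ∀ {y i} → IsVWordAt y i → IsVWord y
IsVWordAt⇒IsVWord {i = i} v = ≤-trans (s≤s 1≤i) i<n , i , 1≤i , i<n , nonincreasing-before , descent-at ,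
                              nondecreasing-after , final<y!i
  where open IsVWordAt v

IsVWord⇒IsVWordAt : ∀ {y} → IsVWord y → ∃ (IsVWordAt y)
IsVWord⇒IsVWordAt (_ , i , 1≤i , i<n , before , at , after , end) = i , record
  { 1≤i = 1≤i ; i<n = i<n ; nonincreasing-before = before ; descent-at = at
  ; nondecreasing-after = after ; final<y!i = end }

module _ {y i} (v : IsVWordAt y i) where
  open IsVWordAt v

  IsVWordAt⇒IsDecrease : ∀ {k} → 1 ≤ k → k ≤ i → IsDecrease y k
  IsVWordAt⇒IsDecrease 1≤k k≤i =
    1≤k , ≤-<-trans k≤i i<n , i , i<n , k≤i ,
    (λ {l} l<i k≤l → nonincreasing-before l (≤-trans 1≤k k≤l) l<i) , descent-at

  IsDecrease⇒≤ : ∀ {k} → IsDecrease y k → k ≤ i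
  IsDecrease⇒≤ (_ , _ , j , j<n , k≤j , _ , descent) =
    ≤-trans k≤j (≮⇒≥ λ i<j → <⇒≱ descent (nondecreasing-after j i<j j<n))

  dec-IsVWordAt : dec y ≡ i
  dec-IsVWordAt = length-filter-upTo (isDecrease? y) i<n (λ { (() , _) }) IsVWordAt⇒IsDecrease
                    (λ i<k _ d → <⇒≱ i<k (IsDecrease⇒≤ d))

record VShape (A B : Word) : Set where
  field
    left-nonempty : 1 ≤ length A
    right-nonempty : 1 ≤ length B
    left-nonincreasing : Linked _≥_ A
    right-nondecreasing : Linked _≤_ B
    first-right<final-left : first B < final A
    final-right<final-left : final B < final A

VShape⇒IsVWordAt : ∀ {A B} → VShape A B → IsVWordAt (A ++ B) (length A)
VShape⇒IsVWordAt {A} {B} s = record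
  { 1≤i = left-nonempty
  ; i<n = <-≤-trans (m<m+n (length A) right-nonempty) (≤-reflexive (sym (length-++ A)))
  ; nonincreasing-before = λ _ → Linked⇒!-++ˡ left-nonincreasing B
  ; descent-at = subst₂ _<_ (sym (!-++-suc-length A B)) (sym (!-++-length A left-nonempty)) first-right<final-left
  ; nondecreasing-after = λ _ → Linked⇒!-++ʳ right-nondecreasing A
  ; final<y!i = subst₂ _<_ (sym (final-++ A right-nonempty)) (sym (!-++-length A left-nonempty)) final-right<final-left
  }
  where open VShape s

IsVWordAt-++⇒VShape : ∀ {A B} → IsVWordAt (A ++ B) (length A) → VShape A B
IsVWordAt-++⇒VShape {A} {B} v = record
  { left-nonempty = 1≤i
  ; right-nonempty = B≢[]
  ; left-nonincreasing = !-++ˡ⇒Linked A B (nonincreasing-before _)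
  ; right-nondecreasing = !-++ʳ⇒Linked A B (nondecreasing-after _)
  ; first-right<final-left = subst₂ _<_ (!-++-suc-length A B) (!-++-length A 1≤i) descent-at
  ; final-right<final-left = subst₂ _<_ (final-++ A B≢[]) (!-++-length A 1≤i) final<y!i
  }
  where
  open IsVWordAt v
  B≢[] : 1 ≤ length B
  B≢[] = +-cancelˡ-< (length A) 0 (length B) (subst₂ _<_ (sym (+-identityʳ _)) (length-++ A) i<n)

φ⁻¹ : Word → ℕ → Word
φ⁻¹ v i = map pred (take i v) ++ reverse (drop i v)

take-++ : ∀ {A : Set} (xs : List A) {ys i} → length xs ≡ i → take i (xs ++ ys) ≡ xs
take-++ [] refl = refl
take-++ (x ∷ xs) refl = cong (x ∷_) (take-++ xs refl)

drop-++ : ∀ {A : Set} (xs : List A) {ys : List A} {i} → length xs ≡ i → drop i (xs ++ ys) ≡ ys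
drop-++ [] refl = refl
drop-++ (x ∷ xs) refl = drop-++ xs refl

length-take-≤ : ∀ {A : Set} {i} (xs : List A) → i ≤ length xs → length (take i xs) ≡ i
length-take-≤ {i = i} xs i≤n = trans (length-take i xs) (m≤n⇒m⊓n≡m i≤n)

1≤length-drop : ∀ {A : Set} {i} (xs : List A) → i < length xs → 1 ≤ length (drop i xs)
1≤length-drop {i = i} xs i<n = subst (1 ≤_) (sym (length-drop i xs)) (m<n⇒0<n∸m i<n)

φ-++ : ∀ T {D i} → length T ≡ i → φ (T ++ D) i ≡ map suc T ++ reverse D
φ-++ T eq = cong₂ (λ T′ D′ → map suc T′ ++ reverse D′) (take-++ T eq) (drop-++ T eq)

φ⁻¹-++ : ∀ A {B i} → length A ≡ i → φ⁻¹ (A ++ B) i ≡ map pred A ++ reverse B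
φ⁻¹-++ A eq = cong₂ (λ A′ B′ → map pred A′ ++ reverse B′) (take-++ A eq) (drop-++ A eq)

length-map-++-reverse : ∀ (f : ℕ → ℕ) A B → length (map f A ++ reverse B) ≡ length (A ++ B)
length-map-++-reverse f A B = begin
  length (map f A ++ reverse B)          ≡⟨ length-++ (map f A) ⟩
  length (map f A) + length (reverse B)  ≡⟨ cong₂ _+_ (length-map f A) (length-reverse B) ⟩
  length A + length B                    ≡⟨ length-++ A ⟨
  length (A ++ B)                        ∎
  where open ≡-Reasoning

length-φ : ∀ w i → length (φ w i) ≡ length w
length-φ w i = trans (length-map-++-reverse suc (take i w) (drop i w)) (cong length (take++drop≡id i w))

length-φ⁻¹ : ∀ v i → length (φ⁻¹ v i) ≡ length v
length-φ⁻¹ v i = trans (length-map-++-reverse pred (take i v) (drop i v)) (cong length (take++drop≡id i v))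

φ⁻¹-φ : ∀ {w i} → i ≤ length w → φ⁻¹ (φ w i) i ≡ w
φ⁻¹-φ {w} {i} i≤n = begin
  φ⁻¹ (map suc T ++ reverse D) i          ≡⟨ φ⁻¹-++ (map suc T) (trans (length-map suc T) (length-take-≤ w i≤n)) ⟩
  map pred (map suc T) ++ reverse (reverse D) ≡⟨ cong₂ _++_ (trans (sym (map-∘ T)) (map-id T)) (reverse-involutive D) ⟩
  T ++ D                                  ≡⟨ take++drop≡id i w ⟩
  w                                       ∎
  where
  open ≡-Reasoning
  T = take i w
  D = drop i w

φ-φ⁻¹ : ∀ {v i} → i ≤ length v → All (1 ≤_) (take i v) → φ (φ⁻¹ v i) i ≡ v
φ-φ⁻¹ {v} {i} i≤n A-positive = begin
  φ (map pred A ++ reverse B) i               ≡⟨ φ-++ (map pred A) (trans (length-map pred A) (length-take-≤ v i≤n)) ⟩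
  map suc (map pred A) ++ reverse (reverse B) ≡⟨ cong₂ _++_ suc-pred-A (reverse-involutive B) ⟩
  A ++ B                                      ≡⟨ take++drop≡id i v ⟩
  v                                           ∎
  where
  open ≡-Reasoning
  A = take i v
  B = drop i v
  suc-pred-A : map suc (map pred A) ≡ A
  suc-pred-A = trans (sym (map-∘ A)) (map-id-local (All.map (λ { (s≤s _) → refl }) A-positive))

sum-map-suc : ∀ xs → sum (map suc xs) ≡ sum xs + length xs
sum-map-suc [] = refl
sum-map-suc (x ∷ xs) = begin
  suc (x + sum (map suc xs))       ≡⟨ cong (suc ∘ (x +_)) (sum-map-suc xs) ⟩
  suc (x + (sum xs + length xs))   ≡⟨ cong suc (+-assoc x (sum xs) (length xs)) ⟨
  suc (x + sum xs + length xs)     ≡⟨ +-suc (x + sum xs) (length xs) ⟨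
  x + sum xs + suc (length xs)     ∎
  where open ≡-Reasoning

tot-φ : ∀ {w i} → i ≤ length w → tot (φ w i) ≡ tot w + i
tot-φ {w} {i} i≤n = begin
  sum (map suc T ++ reverse D)        ≡⟨ sum-++ (map suc T) (reverse D) ⟩
  sum (map suc T) + sum (reverse D)   ≡⟨ cong₂ _+_ (sum-map-suc T) (sum-↭ (↭-reverse D)) ⟩
  sum T + length T + sum D            ≡⟨ xy∙z≈xz∙y (sum T) (length T) (sum D) ⟩
  sum T + sum D + length T            ≡⟨ cong₂ _+_ (sym (sum-++ T D)) (length-take-≤ w i≤n) ⟩
  sum (T ++ D) + i                    ≡⟨ cong (λ u → sum u + i) (take++drop≡id i w) ⟩
  sum w + i                           ∎
  where
  open ≡-Reasoning
  T = take i w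
  D = drop i w

φ-VShape : ∀ T {D} → 1 ≤ length T → 1 ≤ length D → Nonincreasing (T ++ D) → VShape (map suc T) (reverse D)
φ-VShape T {D} T≢[] D≢[] w↘ = record
  { left-nonempty = subst (1 ≤_) (sym (length-map suc T)) T≢[]
  ; right-nonempty = subst (1 ≤_) (sym (length-reverse D)) D≢[]
  ; left-nonincreasing = Linked.map⁺ (Linked.map s≤s T↘)
  ; right-nondecreasing = Linked-reverse D↘
  ; first-right<final-left = subst₂ _<_ (sym (first-reverse D)) (sym (final-map suc T T≢[]))
                               (s≤s (≤-trans (Linked⇒first-final ≤-refl (flip ≤-trans) D↘ D≢[]) bridge))
  ; final-right<final-left = subst₂ _<_ (sym (final-reverse D)) (sym (final-map suc T T≢[])) (s≤s bridge)
  }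
  where
  T↘ = Linked-++⁻ˡ T w↘
  D↘ = Linked-++⁻ʳ T w↘
  bridge : first D ≤ final T
  bridge = Linked-++⇒final-first T T≢[] D≢[] w↘

φ-IsVWordAt : ∀ {w i} → Nonincreasing w → 1 ≤ i → i < length w → IsVWordAt (φ w i) i
φ-IsVWordAt {w} {i} w↘ 1≤i i<n =
  subst (IsVWordAt (φ w i)) (trans (length-map suc T) |T|≡i)
        (VShape⇒IsVWordAt (φ-VShape T (subst (1 ≤_) (sym |T|≡i) 1≤i) (1≤length-drop w i<n)
                                      (subst Nonincreasing (sym (take++drop≡id i w)) w↘)))
  where
  T = take i w
  |T|≡i = length-take-≤ w (<⇒≤ i<n)

φ-letters : ∀ {r w} i → All (_< r) w → All (_≤ r) (φ w i)
φ-letters {w = w} i w<r =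
  ++⁺ (map⁺ (take⁺ i w<r)) (All-resp-↭ (↭-sym (↭-reverse (drop i w))) (drop⁺ i (All.map <⇒≤ w<r)))

module _ {A B} (s : VShape A B) where
  open VShape s

  private
    A≥final : All (_≥ final A) A
    A≥final = Linked⇒All-final ≤-refl (flip ≤-trans) left-nonincreasing

  VShape⇒left-positive : All (1 ≤_) A
  VShape⇒left-positive = All.map (≤-trans (≤-trans (s≤s z≤n) first-right<final-left)) A≥final

  VShape⇒φ⁻¹-nonincreasing : Nonincreasing (map pred A ++ reverse B)
  VShape⇒φ⁻¹-nonincreasing =
    Linked-++⁺ (Linked.map⁺ (Linked.map pred-mono-≤ left-nonincreasing)) (Linked-reverse right-nondecreasing)
               (subst₂ _≥_ (sym (final-map pred A left-nonempty)) (sym (first-reverse B)) (<⇒≤pred final-right<final-left))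

  VShape⇒φ⁻¹-letters : ∀ {r} → All (_≤ r) (A ++ B) → All (_< r) (map pred A ++ reverse B)
  VShape⇒φ⁻¹-letters {r} AB≤r = ++⁺ (map⁺ (All.zipWith pred< (VShape⇒left-positive , A≤r)))
                                    (All-resp-↭ (↭-sym (↭-reverse B)) (All.map (λ b≤ → <-≤-trans (s≤s b≤) final<r) B≤final))
    where
    A≤r = ++⁻ˡ A AB≤r
    pred< : ∀ {a} → 1 ≤ a × a ≤ r → pred a < r
    pred< (s≤s _ , a≤r) = a≤r
    B≤final : All (_≤ final B) B
    B≤final = Linked⇒All-final ≤-refl ≤-trans right-nondecreasing
    final<r : suc (final B) ≤ r
    final<r = <-≤-trans final-right<final-left (All-final A≤r left-nonempty)

IsVWordAt⇒VShape : ∀ {v i} → IsVWordAt v i → VShape (take i v) (drop i v)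
IsVWordAt⇒VShape {v} {i} h =
  IsVWordAt-++⇒VShape (subst₂ IsVWordAt (sym (take++drop≡id i v)) (sym (length-take-≤ v (<⇒≤ (IsVWordAt.i<n h)))) h)

InD⇒IsVWordAt : ∀ {n r w i} → InD n r w i → IsVWordAt (φ w i) i
InD⇒IsVWordAt (refl , w↘ , _ , 1≤i , i<n) = φ-IsVWordAt w↘ 1≤i i<n

φ-InV : ∀ {n r w i} → InD n r w i → InV n r (φ w i)
φ-InV {w = w} {i} d@(refl , _ , w<r , _ , _) = length-φ w i , IsVWordAt⇒IsVWord (InD⇒IsVWordAt d) , φ-letters i w<r

dec-φ : ∀ {n r w i} → InD n r w i → dec (φ w i) ≡ i
dec-φ d = dec-IsVWordAt (InD⇒IsVWordAt d)

φ-injective : ∀ {n r w i w′ i′} → InD n r w i → InD n r w′ i′ → φ w i ≡ φ w′ i′ → w ≡ w′ × i ≡ i′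
φ-injective {w = w} {i} {w′} d d′ eq with trans (sym (dec-φ d)) (trans (cong dec eq) (dec-φ d′))
... | refl = (begin
  w               ≡⟨ φ⁻¹-φ (<⇒≤ (i<length d)) ⟨
  φ⁻¹ (φ w i) i   ≡⟨ cong (λ v → φ⁻¹ v i) eq ⟩
  φ⁻¹ (φ w′ i) i  ≡⟨ φ⁻¹-φ (<⇒≤ (i<length d′)) ⟩
  w′              ∎) , refl
  where
  open ≡-Reasoning
  i<length : ∀ {n r u i} → InD n r u i → i < length u
  i<length (refl , _ , _ , _ , i<n) = i<n

φ-surjective : ∀ {n r v} → InV n r v → ∃ λ w → ∃ λ i → InD n r w i × φ w i ≡ v
φ-surjective {v = v} (|v|≡n , isV , v≤r) with IsVWord⇒IsVWordAt isV
... | i , h = φ⁻¹ v i , i ,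
              (trans (length-φ⁻¹ v i) |v|≡n , VShape⇒φ⁻¹-nonincreasing s , VShape⇒φ⁻¹-letters s AB≤r ,
               IsVWordAt.1≤i h , subst (i <_) |v|≡n (IsVWordAt.i<n h)) ,
              φ-φ⁻¹ (<⇒≤ (IsVWordAt.i<n h)) (VShape⇒left-positive s)
  where
  s = IsVWordAt⇒VShape h
  AB≤r = subst (All (_≤ _)) (sym (take++drop≡id i v)) v≤r

proposition3p1 : ∀ (r n : ℕ) → 1 ≤ r → 2 ≤ n →
    (∀ w i → InD n r w i →
      InV n r (φ w i) × dec (φ w i) ≡ i × tot (φ w i) ≡ tot w + i)
    × (∀ w i w′ i′ → InD n r w i → InD n r w′ i′ → φ w i ≡ φ w′ i′ → w ≡ w′ × i ≡ i′)
    × (∀ v → InV n r v → ∃ λ w → ∃ λ i → InD n r w i × φ w i ≡ v)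
proposition3p1 r n _ _ =
  (λ { w i d@(refl , _ , _ , _ , i<n) → φ-InV d , dec-φ d , tot-φ (<⇒≤ i<n) }) ,
  (λ w i w′ i′ → φ-injective) ,
  (λ v → φ-surjective)
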